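{- For $t=3,4$ we have $rx_3(K_{2,t})=3$, and $rx_3(K_{2,t})\geq 4$ for every $t\geq 5$.
   Context: All graphs are simple, finite and undirected. In an edge-colored graph $G$ (adjacent edges may share colors), a tree is a rainbow tree if no two of its edges have the same color; for $S\subseteq V(G)$, an $S$-tree is a tree in $G$ containing all vertices of $S$. A $3$-rainbow coloring of $G$ is an edge coloring such that for every set $S$ of $3$ vertices there is a rainbow $S$-tree. The $3$-rainbow index $rx_3(G)$ is the minimum number of colors in a $3$-rainbow coloring of $G$. $K_{2,t}$ is the complete bipartite graph with parts of sizes $2$ and $t$. -}

module Defs where

open import Data.Nat using (ℕ; _<_; _≤_; _+_)
open import Data.Fin using (Fin; toℕ)
open import Data.Product using (_×_; _,_; Σ-syntax; ∃-syntax)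
open import Data.Sum using (_⊎_)
open import Data.List using (List; length; map)
open import Data.List.Membership.Propositional using (_∈_)
open import Data.List.Relation.Unary.All using (All)
open import Data.List.Relation.Unary.Unique.Propositional using (Unique)
open import Relation.Binary.PropositionalEquality using (_≡_; _≢_)
open import Relation.Nullary using (¬_)

record Graph (n : ℕ) : Set₁ where
  field
    Adj   : Fin n → Fin n → Set
    sym   : ∀ {u v} → Adj u v → Adj v u
    irrefl : ∀ {u} → ¬ Adj u u
open Graph public

-- An edge coloring with k colors (colors Fin k); the color of edge uv is
-- col u v, required to be symmetric.  Values on non-edges are irrelevant.
record EdgeColoring {n : ℕ} (G : Graph n) (k : ℕ) : Set where
  field
    col     : Fin n → Fin n → Fin k
    col-sym : ∀ u v → col u v ≡ col v u
open EdgeColoring public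

data Reach {n : ℕ} (E : List (Fin n × Fin n)) : Fin n → Fin n → Set where
  here : ∀ {x} → Reach E x x
  fwd  : ∀ {x u v} → (u , v) ∈ E → Reach E v x → Reach E u x
  bwd  : ∀ {x u v} → (u , v) ∈ E → Reach E u x → Reach E v x

-- A tree in G: a subgraph given by a duplicate-free vertex list and a
-- duplicate-free edge list (each edge (u,v) stored with toℕ u < toℕ v,
-- so edges are unordered pairs), every edge an edge of G with both ends
-- among the vertices, connected, and with |E| + 1 = |V| (connected
-- graph with |V| - 1 edges, i.e. a tree).
record Tree {n : ℕ} (G : Graph n) : Set where
  field
    verts     : List (Fin n)
    edges     : List (Fin n × Fin n)
    verts-uniq : Unique verts
    edges-uniq : Unique edges
    edges-ok  : All (λ e → let (u , v) = e in
                      toℕ u < toℕ v × Adj G u v × u ∈ verts × v ∈ verts) edges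
    connected : ∀ {x y} → x ∈ verts → y ∈ verts → Reach edges x y
    count     : length edges + 1 ≡ length verts
open Tree public

Rainbow : ∀ {n k} {G : Graph n} → EdgeColoring G k → Tree G → Set
Rainbow c T = Unique (map (λ e → let (u , v) = e in col c u v) (edges T))

Is3Rainbow : ∀ {n k} {G : Graph n} → EdgeColoring G k → Set
Is3Rainbow {n} {k} {G} c =
  ∀ (x y z : Fin n) → x ≢ y → x ≢ z → y ≢ z →
  Σ[ T ∈ Tree G ] (Rainbow c T × x ∈ verts T × y ∈ verts T × z ∈ verts T)

Has3RainbowColoring : ∀ {n} → Graph n → ℕ → Set
Has3RainbowColoring G k = Σ[ c ∈ EdgeColoring G k ] Is3Rainbow c

Rx3≡ : ∀ {n} → Graph n → ℕ → Set
Rx3≡ G k = Has3RainbowColoring G k × (∀ j → j < k → ¬ Has3RainbowColoring G j)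

Rx3≥ : ∀ {n} → Graph n → ℕ → Set
Rx3≥ G k = ∀ j → j < k → ¬ Has3RainbowColoring G j

-- K_{2,t} on Fin (2 + t): vertices 0,1 form one part, 2..t+1 the other.
K2 : (t : ℕ) → Graph (2 + t)
K2 t = record
  { Adj    = λ u v → (toℕ u < 2 × 2 ≤ toℕ v) ⊎ (2 ≤ toℕ u × toℕ v < 2)
  ; sym    = λ { (Data.Sum.inj₁ (a , b)) → Data.Sum.inj₂ (b , a)
               ; (Data.Sum.inj₂ (a , b)) → Data.Sum.inj₁ (b , a) }
  ; irrefl = λ { (Data.Sum.inj₁ (a , b)) → Data.Nat.Properties.<⇒≱ a b
               ; (Data.Sum.inj₂ (a , b)) → Data.Nat.Properties.<⇒≱ b a } }
  where import Data.Nat.Properties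

module Submission where

-- Write 0, 1 for the two "small" vertices of K_{2,t} and call the others
-- "big".  Every edge joins a small vertex to a big one.
--
-- A tree containing three big vertices x, y, z also contains a
-- small neighbour of x, so it has at least four vertices and three edges; a
-- rainbow such tree needs three colours.  With exactly three colours it has
-- exactly four vertices, hence is a star at a small centre, so x, y, z are
-- joined to vertex 0 or to vertex 1 in three distinct colours.  For five big
-- vertices this is impossible: if the colours a, b at 0 and 1 made every
-- triple rainbow at 0 or at 1 (a "rainbow cover"), a pigeonhole pair with
-- equal a-colour forces, through the uniqueness of the third colour in Fin 3,
-- a chain of equalities ending in a contradiction.
--
-- Explicit 3-colourings of K_{2,3} and K_{2,4} are verified by
-- a certificate search: for each triple, the stars and "brooms" of K_{2,t}
-- are tried, and every candidate is checked against the definition of a tree.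

open import Defs hiding (sym)
open import Data.Nat using (ℕ; zero; suc; _≤_; _<_; z≤n; s≤s; _+_; _<?_; _≤?_) renaming (_≟_ to _≟ℕ_)
open import Data.Nat.Properties using (<⇒≱; <-asym; <-≤-trans; ≤-trans; ≤-pred; +-comm; m<1+n⇒m<n∨m≡n)
open import Data.Fin using (Fin; zero; suc; toℕ; inject≤; _≟_; #_)
open import Data.Fin.Properties using (pigeonhole; injective⇒≤; inject≤-injective; suc-injective; <⇒≢)
open import Data.List using (List; []; _∷_; length; map; lookup; filter; allFin; concatMap; _++_; foldr; deduplicate)
open import Data.List.Properties using (length-map)
open import Data.List.Membership.Propositional using (_∈_)
open import Data.List.Membership.Propositional.Properties using (∈-lookup)
open import Data.List.Relation.Unary.Any using (here; there; index)
open import Data.List.Relation.Unary.Any.Properties using (lookup-index)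
open import Data.List.Relation.Unary.All as All using (All; []; _∷_)
open import Data.List.Relation.Unary.All.Properties using (map⁻)
open import Data.List.Relation.Unary.AllPairs using ([]; _∷_)
open import Data.List.Relation.Unary.Unique.Propositional using (Unique)
import Data.List.Relation.Unary.Unique.DecPropositional as UniqueDec
import Data.Vec as Vec
open import Data.Vec using (_∷_; [])
open import Data.Maybe using (Maybe; just; nothing; from-just; _>>=_)
import Data.Maybe as Maybe
import Data.Maybe.Effectful as Maybe
open import Level using (0ℓ)
open import Data.Product using (_×_; _,_; proj₁; proj₂; ∃-syntax; Σ-syntax)
open import Data.Product.Properties using (≡-dec)
open import Data.Sum using (_⊎_; inj₁; inj₂)
open import Data.Empty using (⊥-elim)
open import Function using (Injective; _∘_)
open import Relation.Nullary using (¬_; Dec; yes; no; ¬?)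
open import Relation.Nullary.Decidable using (_×-dec_; _⊎-dec_; dec⇒maybe)
open import Relation.Binary.PropositionalEquality using (_≡_; _≢_; refl; sym; trans; cong; subst; ≢-sym; module ≡-Reasoning)

private
  variable
    A B : Set

Distinct3 : A → A → A → Set
Distinct3 x y z = x ≢ y × x ≢ z × y ≢ z

every : ∀ {n} {P : Fin n → Set} → ((x : Fin n) → Maybe (P x)) → Maybe ((x : Fin n) → P x)
every {zero}      _ = just (λ ())
every {suc n} {P} f = f zero >>= λ p₀ → every {P = λ i → P (suc i)} (λ i → f (suc i)) >>= λ pₛ →
  just (λ { zero → p₀ ; (suc i) → pₛ i })

unique-lookup-injective : ∀ {xs : List A} → Unique xs → Injective _≡_ _≡_ (lookup xs)
unique-lookup-injective {xs = _ ∷ _}  _          {zero}  {zero}  _  = refl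
unique-lookup-injective {xs = _ ∷ xs} (x∉ ∷ _)   {zero}  {suc j} eq = ⊥-elim (All.lookup x∉ (∈-lookup {xs = xs} j) eq)
unique-lookup-injective {xs = _ ∷ xs} (x∉ ∷ _)   {suc i} {zero}  eq = ⊥-elim (All.lookup x∉ (∈-lookup {xs = xs} i) (sym eq))
unique-lookup-injective {xs = _ ∷ _}  (_ ∷ uniq) {suc i} {suc j} eq = cong suc (unique-lookup-injective uniq eq)

unique-length-≤ : ∀ {k} {xs : List (Fin k)} → Unique xs → length xs ≤ k
unique-length-≤ uniq = injective⇒≤ (unique-lookup-injective uniq)

unique-⊆-length : ∀ {xs ys : List A} → Unique ys → (∀ {z} → z ∈ ys → z ∈ xs) → length ys ≤ length xs
unique-⊆-length {xs = xs} {ys} uniq ys⊆xs = injective⇒≤ {f = position} position-injective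
  where
  position : Fin (length ys) → Fin (length xs)
  position i = index (ys⊆xs (∈-lookup i))

  position-injective : Injective _≡_ _≡_ position
  position-injective {i} {j} same-position = unique-lookup-injective uniq (begin
    lookup ys i            ≡⟨ lookup-index (ys⊆xs (∈-lookup i)) ⟩
    lookup xs (position i) ≡⟨ cong (lookup xs) same-position ⟩
    lookup xs (position j) ≡⟨ sym (lookup-index (ys⊆xs (∈-lookup j))) ⟩
    lookup ys j            ∎)
    where open ≡-Reasoning

unique-map-injective : ∀ (f : A → B) {xs} → Unique (map f xs) → ∀ {x y} → x ∈ xs → y ∈ xs → f x ≡ f y → x ≡ y
unique-map-injective f (_   ∷ _)    (here refl) (here refl) _  = refl
unique-map-injective f (fx∉ ∷ _)    (here refl) (there y∈)  eq = ⊥-elim (All.lookup (map⁻ fx∉) y∈ eq)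
unique-map-injective f (fy∉ ∷ _)    (there x∈)  (here refl) eq = ⊥-elim (All.lookup (map⁻ fy∉) x∈ (sym eq))
unique-map-injective f (_   ∷ uniq) (there x∈)  (there y∈)  eq = unique-map-injective f uniq x∈ y∈ eq

no-four-in-three : ∀ {p q r s : Fin 3} → ¬ Unique (p ∷ q ∷ r ∷ s ∷ [])
no-four-in-three uniq with unique-length-≤ uniq
... | s≤s (s≤s (s≤s ()))

third-colour-unique : ∀ {p q r s : Fin 3} → Distinct3 p q r → Distinct3 p q s → r ≡ s
third-colour-unique {r = r} {s} (p≢q , p≢r , q≢r) (_ , p≢s , q≢s) with r ≟ s
... | yes r≡s = r≡s
... | no  r≢s = ⊥-elim (no-four-in-three ((p≢q ∷ p≢r ∷ p≢s ∷ []) ∷ (q≢r ∷ q≢s ∷ []) ∷ (r≢s ∷ []) ∷ [] ∷ []))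

RainbowCover : {V : Set} → (V → Fin 3) → (V → Fin 3) → Set
RainbowCover {V} a b = ∀ {x y z : V} → Distinct3 x y z →
  Distinct3 (a x) (a y) (a z) ⊎ Distinct3 (b x) (b y) (b z)

swap-cover : ∀ {V} {a b : V → Fin 3} → RainbowCover a b → RainbowCover b a
swap-cover cover xyz with cover xyz
... | inj₁ rainbow-a = inj₂ rainbow-a
... | inj₂ rainbow-b = inj₁ rainbow-b

module _ {V : Set} {a b : V → Fin 3} (cover : RainbowCover a b) where

  b-rainbow : ∀ {v w u} → Distinct3 v w u → a v ≡ a w → Distinct3 (b v) (b w) (b u)
  b-rainbow vwu av≡aw with cover vwu
  ... | inj₁ (av≢aw , _) = ⊥-elim (av≢aw av≡aw)
  ... | inj₂ rainbow-b   = rainbow-b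

  forced-colour : ∀ {v w u u′} → Distinct3 v w u → Distinct3 v w u′ → a v ≡ a w → b u ≡ b u′
  forced-colour vwu vwu′ av≡aw = third-colour-unique (b-rainbow vwu av≡aw) (b-rainbow vwu′ av≡aw)

-- Among five distinct vertices under a rainbow cover no pair v, w has equal
-- a-colour: otherwise, calling the others u₁ u₂ u₃, we get b u₁ ≡ b u₂, then
-- (roles of a and b swapped) a v ≡ a u₃, then b w ≡ b u₁, whereas the
-- b-rainbow triple v w u₁ has b w ≢ b u₁.
no-equal-pair-in-five : ∀ {V} {a b : V → Fin 3} → RainbowCover a b →
  ∀ {v w u₁ u₂ u₃} → Unique (v ∷ w ∷ u₁ ∷ u₂ ∷ u₃ ∷ []) → a v ≢ a w
no-equal-pair-in-five {a = a} {b} cover {v} {w} {u₁} {u₂} {u₃}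
  ((v≢w ∷ v≢u₁ ∷ v≢u₂ ∷ v≢u₃ ∷ []) ∷ (w≢u₁ ∷ w≢u₂ ∷ w≢u₃ ∷ []) ∷ (u₁≢u₂ ∷ u₁≢u₃ ∷ []) ∷ (u₂≢u₃ ∷ []) ∷ [] ∷ [])
  av≡aw = bw≢bu₁ bw≡bu₁
  where
  bu₁≡bu₂ : b u₁ ≡ b u₂
  bu₁≡bu₂ = forced-colour cover (v≢w , v≢u₁ , w≢u₁) (v≢w , v≢u₂ , w≢u₂) av≡aw

  av≡au₃ : a v ≡ a u₃
  av≡au₃ = forced-colour (swap-cover cover) (u₁≢u₂ , ≢-sym v≢u₁ , ≢-sym v≢u₂) (u₁≢u₂ , u₁≢u₃ , u₂≢u₃) bu₁≡bu₂

  bw≡bu₁ : b w ≡ b u₁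
  bw≡bu₁ = forced-colour cover (v≢u₃ , v≢w , ≢-sym w≢u₃) (v≢u₃ , v≢u₁ , ≢-sym u₁≢u₃) av≡au₃

  bw≢bu₁ : b w ≢ b u₁
  bw≢bu₁ = proj₂ (proj₂ (b-rainbow cover (v≢w , v≢u₁ , w≢u₁) av≡aw))

extend-to-five : ∀ (i j : Fin 5) → i ≢ j → ∃[ u₁ ] ∃[ u₂ ] ∃[ u₃ ] Unique (i ∷ j ∷ u₁ ∷ u₂ ∷ u₃ ∷ [])
extend-to-five = from-just (every λ i → every λ j → extend i j)
  where
  extend : (i j : Fin 5) → Maybe (i ≢ j → ∃[ u₁ ] ∃[ u₂ ] ∃[ u₃ ] Unique (i ∷ j ∷ u₁ ∷ u₂ ∷ u₃ ∷ []))
  extend i j with i ≟ j | filter (λ u → ¬? (u ≟ i) ×-dec ¬? (u ≟ j)) (allFin 5)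
  ... | yes refl | _                  = just (λ i≢i → ⊥-elim (i≢i refl))
  ... | no _     | u₁ ∷ u₂ ∷ u₃ ∷ [] =
    Maybe.map (λ uniq _ → u₁ , u₂ , u₃ , uniq) (dec⇒maybe (UniqueDec.unique? _≟_ (i ∷ j ∷ u₁ ∷ u₂ ∷ u₃ ∷ [])))
  ... | no _     | _                  = nothing

no-rainbow-cover-of-five : (a b : Fin 5 → Fin 3) → ¬ RainbowCover a b
no-rainbow-cover-of-five a b cover with pigeonhole (s≤s (s≤s (s≤s (s≤s z≤n)))) a
... | i , j , i<j , ai≡aj with extend-to-five i j (<⇒≢ i<j)
...   | _ , _ , _ , enumeration = no-equal-pair-in-five cover enumeration ai≡aj

vertex-count : ∀ {n} {G : Graph n} (T : Tree G) → length (verts T) ≡ suc (length (edges T))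
vertex-count T = trans (sym (count T)) (+-comm (length (edges T)) 1)

module _ {n k} {G : Graph n} (c : EdgeColoring G k) (T : Tree G) (rainbow : Rainbow c T) where

  edge-colour : Fin n × Fin n → Fin k
  edge-colour (u , v) = col c u v

  rainbow-edge-count : length (edges T) ≤ k
  rainbow-edge-count = subst (_≤ k) (length-map edge-colour (edges T)) (unique-length-≤ rainbow)

  rainbow-edges-differ : ∀ {e f} → e ∈ edges T → f ∈ edges T → edge-colour e ≡ edge-colour f → e ≡ f
  rainbow-edges-differ = unique-map-injective edge-colour rainbow

Small Big : ∀ {t} → Fin (2 + t) → Set
Small v = toℕ v < 2
Big   v = 2 ≤ toℕ v

small≢big : ∀ {t} {s w : Fin (2 + t)} → Small s → Big w → s ≢ w
small≢big s<2 2≤w refl = <⇒≱ s<2 2≤w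

edge-ends : ∀ {t} (T : Tree (K2 t)) {u v} → (u , v) ∈ edges T → Small u × Big v × u ∈ verts T
edge-ends T e∈ with All.lookup (edges-ok T) e∈
... | _   , inj₁ (u<2 , 2≤v) , u∈ , _ = u<2 , 2≤v , u∈
... | u<v , inj₂ (2≤u , v<2) , _       = ⊥-elim (<-asym u<v (<-≤-trans v<2 2≤u))

small-neighbour : ∀ {t} (T : Tree (K2 t)) {w y} → Big w → w ≢ y → Reach (edges T) w y →
  ∃[ s ] Small s × (s , w) ∈ edges T
small-neighbour T bw w≢y here               = ⊥-elim (w≢y refl)
small-neighbour T bw _   (fwd e∈ _)         = ⊥-elim (<⇒≱ (proj₁ (edge-ends T e∈)) bw)
small-neighbour T bw _   (bwd {u = s} e∈ _) = s , proj₁ (edge-ends T e∈) , e∈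

module RainbowTreeOnBigTriple {t k} (c : EdgeColoring (K2 t) k) (T : Tree (K2 t)) (rainbow : Rainbow c T)
  {x y z} (bx : Big x) (by : Big y) (bz : Big z) (xyz : Distinct3 x y z)
  (x∈ : x ∈ verts T) (y∈ : y ∈ verts T) (z∈ : z ∈ verts T) where

  x≢y : x ≢ y
  x≢y = proj₁ xyz
  x≢z : x ≢ z
  x≢z = proj₁ (proj₂ xyz)
  y≢z : y ≢ z
  y≢z = proj₂ (proj₂ xyz)

  x-neighbour : ∃[ s ] Small s × (s , x) ∈ edges T
  x-neighbour = small-neighbour T bx x≢y (connected T x∈ y∈)

  centre : Fin (2 + t)
  centre = proj₁ x-neighbour

  centre-small : Small centre
  centre-small = proj₁ (proj₂ x-neighbour)

  core : List (Fin (2 + t))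
  core = centre ∷ x ∷ y ∷ z ∷ []

  core-unique : Unique core
  core-unique =
    (small≢big centre-small bx ∷ small≢big centre-small by ∷ small≢big centre-small bz ∷ [])
      ∷ (x≢y ∷ x≢z ∷ []) ∷ (y≢z ∷ []) ∷ [] ∷ []

  core⊆verts : ∀ {v} → v ∈ core → v ∈ verts T
  core⊆verts (here refl)                         = proj₂ (proj₂ (edge-ends T (proj₂ (proj₂ x-neighbour))))
  core⊆verts (there (here refl))                 = x∈
  core⊆verts (there (there (here refl)))         = y∈
  core⊆verts (there (there (there (here refl)))) = z∈

  three-colours : 3 ≤ k
  three-colours = ≤-trans (≤-pred (subst (4 ≤_) (vertex-count T) (unique-⊆-length core-unique core⊆verts)))
                          (rainbow-edge-count c T rainbow)

  -- With only three colours T has exactly the four vertices of core, so the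
  -- centre is its only small vertex, T is the star at the centre, and the
  -- rainbow condition makes the spokes to x, y, z differently coloured.
  module ThreeColours (k≤3 : k ≤ 3) where

    at-most-four : length (verts T) ≤ 4
    at-most-four = subst (_≤ 4) (sym (vertex-count T)) (s≤s (≤-trans (rainbow-edge-count c T rainbow) k≤3))

    only-small : ∀ {s} → Small s → s ∈ verts T → s ≡ centre
    only-small {s} s-small s∈ with s ≟ centre
    ... | yes s≡centre = s≡centre
    ... | no  s≢centre = ⊥-elim (<⇒≱ (s≤s (s≤s (s≤s (s≤s (s≤s z≤n))))) (≤-trans five-vertices at-most-four))
      where
      five-vertices : 5 ≤ length (verts T)
      five-vertices = unique-⊆-length
        ((s≢centre ∷ small≢big s-small bx ∷ small≢big s-small by ∷ small≢big s-small bz ∷ []) ∷ core-unique)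
        λ { (here refl) → s∈ ; (there v∈core) → core⊆verts v∈core }

    spoke : ∀ {w} → Big w → w ∈ verts T → (centre , w) ∈ edges T
    spoke {w} bw w∈ with small-neighbour T bw (≢-sym (small≢big centre-small bw)) (connected T w∈ (core⊆verts (here refl)))
    ... | s , s-small , s-w∈ =
      subst (λ s′ → (s′ , w) ∈ edges T) (only-small s-small (proj₂ (proj₂ (edge-ends T s-w∈)))) s-w∈

    spokes-differ : ∀ {v w} → Big v → Big w → v ∈ verts T → w ∈ verts T → v ≢ w → col c centre v ≢ col c centre w
    spokes-differ bv bw v∈ w∈ v≢w same =
      v≢w (cong proj₂ (rainbow-edges-differ c T rainbow (spoke bv v∈) (spoke bw w∈) same))

    rainbow-centre : Distinct3 (col c centre x) (col c centre y) (col c centre z)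
    rainbow-centre = spokes-differ bx by x∈ y∈ x≢y , spokes-differ bx bz x∈ z∈ x≢z , spokes-differ by bz y∈ z∈ y≢z

big-vertex : ∀ {m t} → m ≤ t → Fin m → Fin (2 + t)
big-vertex m≤t i = suc (suc (inject≤ i m≤t))

big-vertex-big : ∀ {m t} (m≤t : m ≤ t) (i : Fin m) → Big (big-vertex m≤t i)
big-vertex-big _ _ = s≤s (s≤s z≤n)

big-vertices-distinct : ∀ {m t} (m≤t : m ≤ t) {i j k : Fin m} → Distinct3 i j k →
  Distinct3 (big-vertex m≤t i) (big-vertex m≤t j) (big-vertex m≤t k)
big-vertices-distinct m≤t (i≢j , i≢k , j≢k) = distinct i≢j , distinct i≢k , distinct j≢k
  where
  distinct : ∀ {i j} → i ≢ j → big-vertex m≤t i ≢ big-vertex m≤t j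
  distinct i≢j same = i≢j (inject≤-injective m≤t m≤t _ _ (suc-injective (suc-injective same)))

at-least-three-colours : ∀ {t k} → 3 ≤ t → Has3RainbowColoring (K2 t) k → 3 ≤ k
at-least-three-colours {t} {k} 3≤t (c , is-rainbow) =
  analyse (is-rainbow x y z (proj₁ xyz) (proj₁ (proj₂ xyz)) (proj₂ (proj₂ xyz)))
  where
  x y z : Fin (2 + t)
  x = big-vertex 3≤t zero
  y = big-vertex 3≤t (suc zero)
  z = big-vertex 3≤t (suc (suc zero))

  xyz : Distinct3 x y z
  xyz = big-vertices-distinct 3≤t ((λ ()) , (λ ()) , (λ ()))

  analyse : Σ[ T ∈ Tree (K2 t) ] (Rainbow c T × x ∈ verts T × y ∈ verts T × z ∈ verts T) → 3 ≤ k
  analyse (T , rainbow , x∈ , y∈ , z∈) = RainbowTreeOnBigTriple.three-colours c T rainbow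
    (big-vertex-big 3≤t _) (big-vertex-big 3≤t _) (big-vertex-big 3≤t _) xyz x∈ y∈ z∈

small-rainbow-cover : ∀ {t} (c : EdgeColoring (K2 t) 3) → Is3Rainbow c → ∀ {x y z} →
  Big x → Big y → Big z → Distinct3 x y z →
  Distinct3 (col c zero x) (col c zero y) (col c zero z) ⊎ Distinct3 (col c (suc zero) x) (col c (suc zero) y) (col c (suc zero) z)
small-rainbow-cover c is-rainbow {x} {y} {z} bx by bz xyz@(x≢y , x≢z , y≢z) with is-rainbow x y z x≢y x≢z y≢z
... | T , rainbow , x∈ , y∈ , z∈ = at-small-vertex centre centre-small rainbow-centre
  where
  open RainbowTreeOnBigTriple c T rainbow bx by bz xyz x∈ y∈ z∈
  open ThreeColours (s≤s (s≤s (s≤s z≤n)))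

  at-small-vertex : ∀ s → Small s → Distinct3 (col c s x) (col c s y) (col c s z) →
    Distinct3 (col c zero x) (col c zero y) (col c zero z) ⊎ Distinct3 (col c (suc zero) x) (col c (suc zero) y) (col c (suc zero) z)
  at-small-vertex zero          _              rainbow-at-0 = inj₁ rainbow-at-0
  at-small-vertex (suc zero)    _              rainbow-at-1 = inj₂ rainbow-at-1
  at-small-vertex (suc (suc _)) (s≤s (s≤s ())) _

-- Lower bound 4 for t ≥ 5: the colours seen from vertices 0 and 1 on five big
-- vertices would form a rainbow cover.
no-three-colours : ∀ {t} → 5 ≤ t → ¬ Has3RainbowColoring (K2 t) 3
no-three-colours {t} 5≤t (c , is-rainbow) = no-rainbow-cover-of-five (colours-at zero) (colours-at (suc zero)) cover
  where
  colours-at : Fin (2 + t) → Fin 5 → Fin 3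
  colours-at s i = col c s (big-vertex 5≤t i)

  cover : RainbowCover (colours-at zero) (colours-at (suc zero))
  cover ijk = small-rainbow-cover c is-rainbow
    (big-vertex-big 5≤t _) (big-vertex-big 5≤t _) (big-vertex-big 5≤t _) (big-vertices-distinct 5≤t ijk)

module _ {n} {E : List (Fin n × Fin n)} where

  reach-trans : ∀ {x y z} → Reach E x y → Reach E y z → Reach E x z
  reach-trans here       q = q
  reach-trans (fwd e∈ p) q = fwd e∈ (reach-trans p q)
  reach-trans (bwd e∈ p) q = bwd e∈ (reach-trans p q)

  reach-sym : ∀ {x y} → Reach E x y → Reach E y x
  reach-sym here       = here
  reach-sym (fwd e∈ p) = reach-trans (reach-sym p) (bwd e∈ here)
  reach-sym (bwd e∈ p) = reach-trans (reach-sym p) (fwd e∈ here)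

  walk? : ℕ → (x y : Fin n) → Maybe (Reach E x y)
  walk? fuel x y with x ≟ y
  walk? _          x .x | yes refl = just here
  walk? zero       x y  | no _     = nothing
  walk? (suc fuel) x y  | no _     = first-step E (λ e∈ → e∈)
    where
    first-step : (F : List (Fin n × Fin n)) → (∀ {e} → e ∈ F → e ∈ E) → Maybe (Reach E x y)
    first-step []            _    = nothing
    first-step ((u , v) ∷ F) F⊆E = forward Maybe.<∣> backward Maybe.<∣> first-step F (F⊆E ∘ there)
      where
      forward backward : Maybe (Reach E x y)
      forward with u ≟ x
      ... | yes refl = Maybe.map (fwd (F⊆E (here refl))) (walk? fuel v y)
      ... | no _     = nothing
      backward with v ≟ x
      ... | yes refl = Maybe.map (bwd (F⊆E (here refl))) (walk? fuel u y)
      ... | no _     = nothing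

  -- Connectivity is certified by walks from every vertex to the first one;
  -- on |V| vertices a walk needs fewer than |V| steps.
  connected? : (V : List (Fin n)) → Maybe (∀ {x y} → x ∈ V → y ∈ V → Reach E x y)
  connected? []           = just (λ ())
  connected? V@(root ∷ _) =
    Maybe.map joined (All.sequenceA 0ℓ Maybe.applicative (All.tabulate {xs = V} λ {v} _ → walk? (length V) v root))
    where
    joined : All (λ v → Reach E v root) V → ∀ {x y} → x ∈ V → y ∈ V → Reach E x y
    joined to-root x∈ y∈ = reach-trans (All.lookup to-root x∈) (reach-sym (All.lookup to-root y∈))

module TreeSearch {n} (G : Graph n) (adj? : ∀ u v → Dec (Adj G u v)) where
  open import Data.List.Membership.DecPropositional (_≟_ {n}) using (_∈?_)

  tree? : List (Fin n) → List (Fin n × Fin n) → Maybe (Tree G)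
  tree? V E =
    dec⇒maybe (UniqueDec.unique? _≟_ V) >>= λ V-unique →
    dec⇒maybe (UniqueDec.unique? (≡-dec _≟_ _≟_) E) >>= λ E-unique →
    dec⇒maybe (All.all? (λ (u , v) → toℕ u <? toℕ v ×-dec adj? u v ×-dec u ∈? V ×-dec v ∈? V) E) >>= λ E-ok →
    connected? V >>= λ V-connected →
    dec⇒maybe (length E + 1 ≟ℕ length V) >>= λ E-count →
    just (record { verts = V ; edges = E ; verts-uniq = V-unique ; edges-uniq = E-unique
                 ; edges-ok = E-ok ; connected = V-connected ; count = E-count })

  certifies? : ∀ {k} (c : EdgeColoring G k) (x y z : Fin n) (T : Tree G) →
    Maybe (Rainbow c T × x ∈ verts T × y ∈ verts T × z ∈ verts T)
  certifies? c x y z T =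
    dec⇒maybe (UniqueDec.unique? _≟_ _ ×-dec x ∈? verts T ×-dec y ∈? verts T ×-dec z ∈? verts T)

K2-adj? : ∀ t (u v : Fin (2 + t)) → Dec (Adj (K2 t) u v)
K2-adj? t u v = (toℕ u <? 2 ×-dec 2 ≤? toℕ v) ⊎-dec (2 ≤? toℕ u ×-dec toℕ v <? 2)

module K2Search (t : ℕ) where
  open TreeSearch (K2 t) (K2-adj? t)

  Vertex : Set
  Vertex = Fin (2 + t)

  Candidate : Set
  Candidate = List Vertex × List (Vertex × Vertex)

  attachments : List Vertex → List (List (Vertex × Vertex))
  attachments []       = [] ∷ []
  attachments (w ∷ ws) = concatMap (λ es → ((zero , w) ∷ es) ∷ ((suc zero , w) ∷ es) ∷ []) (attachments ws)

  -- The S-trees of K_{2,t} whose leaves lie in S: stars at a small vertex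
  -- over the big vertices of S, and brooms, i.e. a path 0 - m - 1 through a
  -- big hub m with every other big vertex of S attached to 0 or to 1.
  candidates : List Vertex → List Candidate
  candidates S = map star (zero ∷ suc zero ∷ []) ++ concatMap brooms (map big (allFin t))
    where
    big : Fin t → Vertex
    big w = suc (suc w)

    bigs : List Vertex
    bigs = filter (λ v → 2 ≤? toℕ v) (deduplicate _≟_ S)

    star : Vertex → Candidate
    star s = s ∷ bigs , map (s ,_) bigs

    brooms : Vertex → List Candidate
    brooms m = map (λ es → zero ∷ suc zero ∷ m ∷ others , (zero , m) ∷ (suc zero , m) ∷ es) (attachments others)
      where
      others : List Vertex
      others = filter (λ v → ¬? (v ≟ m)) bigs

  rainbow-tree? : ∀ {k} (c : EdgeColoring (K2 t) k) (x y z : Vertex) →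
    Maybe (Σ[ T ∈ Tree (K2 t) ] (Rainbow c T × x ∈ verts T × y ∈ verts T × z ∈ verts T))
  rainbow-tree? c x y z = foldr (λ (V , E) rest → try V E Maybe.<∣> rest) nothing (candidates (x ∷ y ∷ z ∷ []))
    where
    try : List Vertex → List (Vertex × Vertex) →
      Maybe (Σ[ T ∈ Tree (K2 t) ] (Rainbow c T × x ∈ verts T × y ∈ verts T × z ∈ verts T))
    try V E = tree? V E >>= λ T → Maybe.map (T ,_) (certifies? c x y z T)

  three-rainbow? : ∀ {k} (c : EdgeColoring (K2 t) k) → Maybe (Is3Rainbow c)
  three-rainbow? c =
    Maybe.map (λ found x y z _ _ _ → found x y z) (every λ x → every λ y → every λ z → rainbow-tree? c x y z)

two-row-colouring : ∀ {t k} → (Fin t → Fin (suc k)) → (Fin t → Fin (suc k)) → EdgeColoring (K2 t) (suc k)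
two-row-colouring {t} {k} a b = record { col = colour ; col-sym = colour-sym }
  where
  colour : Fin (2 + t) → Fin (2 + t) → Fin (suc k)
  colour zero          (suc (suc w)) = a w
  colour (suc zero)    (suc (suc w)) = b w
  colour (suc (suc w)) zero          = a w
  colour (suc (suc w)) (suc zero)    = b w
  colour _             _             = zero

  colour-sym : ∀ u v → colour u v ≡ colour v u
  colour-sym zero          zero          = refl
  colour-sym zero          (suc zero)    = refl
  colour-sym zero          (suc (suc _)) = refl
  colour-sym (suc zero)    zero          = refl
  colour-sym (suc zero)    (suc zero)    = refl
  colour-sym (suc zero)    (suc (suc _)) = refl
  colour-sym (suc (suc _)) zero          = refl
  colour-sym (suc (suc _)) (suc zero)    = refl
  colour-sym (suc (suc _)) (suc (suc _)) = refl

colouring-K₂₃ : EdgeColoring (K2 3) 3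
colouring-K₂₃ = two-row-colouring (Vec.lookup (# 0 ∷ # 0 ∷ # 1 ∷ [])) (Vec.lookup (# 1 ∷ # 2 ∷ # 0 ∷ []))

colouring-K₂₄ : EdgeColoring (K2 4) 3
colouring-K₂₄ = two-row-colouring (Vec.lookup (# 0 ∷ # 0 ∷ # 1 ∷ # 2 ∷ [])) (Vec.lookup (# 1 ∷ # 2 ∷ # 0 ∷ # 0 ∷ []))

rainbow-K₂₃ : Is3Rainbow colouring-K₂₃
rainbow-K₂₃ = from-just (K2Search.three-rainbow? 3 colouring-K₂₃)

rainbow-K₂₄ : Is3Rainbow colouring-K₂₄
rainbow-K₂₄ = from-just (K2Search.three-rainbow? 4 colouring-K₂₄)

lemma2p3 : (Rx3≡ (K2 3) 3 × Rx3≡ (K2 4) 3) × (∀ (t : ℕ) → 5 ≤ t → Rx3≥ (K2 t) 4)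
lemma2p3 =
  ( ((colouring-K₂₃ , rainbow-K₂₃) , fewer-than-three (s≤s (s≤s (s≤s z≤n))))
  , ((colouring-K₂₄ , rainbow-K₂₄) , fewer-than-three (s≤s (s≤s (s≤s z≤n)))) )
  , fewer-than-four
  where
  fewer-than-three : ∀ {t} → 3 ≤ t → Rx3≥ (K2 t) 3
  fewer-than-three 3≤t j j<3 coloured = <⇒≱ j<3 (at-least-three-colours 3≤t coloured)

  fewer-than-four : ∀ t → 5 ≤ t → Rx3≥ (K2 t) 4
  fewer-than-four t 5≤t j j<4 with m<1+n⇒m<n∨m≡n j<4
  ... | inj₁ j<3  = fewer-than-three (≤-trans (s≤s (s≤s (s≤s z≤n))) 5≤t) j j<3
  ... | inj₂ refl = no-three-colours 5≤t
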